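{- Let $r\ge 1$ and let $n\ge 2$ be even. Let $rK_{1,n}$ denote the disjoint union of $r$ copies of the star $K_{1,n}$. Then $\chi_{la}(rK_{1,n})=rn+1$.
   Context: For a graph $G=(V,E)$ without $K_2$ components, a bijection $f:E\to\{1,2,\dots,|E|\}$ induces the weight $w(u)=\sum_{uv\in E} f(uv)$ of each vertex $u$. The bijection $f$ is a local antimagic labeling if $w(u)\neq w(v)$ for every edge $uv$. The local antimagic chromatic number $\chi_{la}(G)$ is the minimum number of distinct weights over all local antimagic labelings of $G$. $K_{1,n}$ is the star with one center and $n$ leaves. -}

module Defs where

open import Data.Nat using (ℕ; zero; suc; _+_; _*_; _≤_)
open import Data.Fin using (Fin; zero; suc; toℕ; combine)
import Data.Fin as Fin
import Data.Nat as ℕ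
open import Data.List using (List; map; allFin; length; deduplicate)
open import Data.Nat.ListAction using (sum)
open import Data.Product using (_×_; _,_; proj₁; proj₂; ∃)
open import Data.Bool using (Bool; if_then_else_; _∨_)
open import Function.Bundles using (_⤖_; Bijection)
open import Relation.Nullary using (¬_)
open import Relation.Nullary.Decidable using (⌊_⌋)
open import Relation.Binary.PropositionalEquality using (_≡_)

record Graph : Set where
  constructor mkGraph
  field
    v     : ℕ
    m     : ℕ
    ends  : Fin m → Fin v × Fin v

open Graph public

incident : (G : Graph) → Fin (m G) → Fin (v G) → Bool
incident G e u = ⌊ proj₁ (ends G e) Fin.≟ u ⌋ ∨ ⌊ proj₂ (ends G e) Fin.≟ u ⌋

-- An edge labeling is a bijection f : E → {1,…,|E|}; we represent it as a
-- bijection Fin m ⤖ Fin m, the label of e being 1 + toℕ (f e).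
Labeling : Graph → Set
Labeling G = Fin (m G) ⤖ Fin (m G)

label : (G : Graph) → Labeling G → Fin (m G) → ℕ
label G f e = suc (toℕ (Bijection.to f e))

weight : (G : Graph) → Labeling G → Fin (v G) → ℕ
weight G f u =
  sum (map (λ e → if incident G e u then label G f e else 0) (allFin (m G)))

IsLocalAntimagic : (G : Graph) → Labeling G → Set
IsLocalAntimagic G f =
  (e : Fin (m G)) → ¬ (weight G f (proj₁ (ends G e)) ≡ weight G f (proj₂ (ends G e)))

numWeights : (G : Graph) → Labeling G → ℕ
numWeights G f = length (deduplicate ℕ._≟_ (map (weight G f) (allFin (v G))))

ChiLaIs : Graph → ℕ → Set
ChiLaIs G k =
  (∃ λ f → IsLocalAntimagic G f × numWeights G f ≡ k)
  × ((f : Labeling G) → IsLocalAntimagic G f → k ≤ numWeights G f)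

-- The graph r K_{1,n}: vertices Fin (r * (1 + n)), vertex (i , j) of copy i
-- encoded as combine i j, where j = 0 is the centre and j = suc t are leaves.
rStar : (r n : ℕ) → Graph
rStar r n = mkGraph (r * suc n) (r * n) edge
  where
    edge : Fin (r * n) → Fin (r * suc n) × Fin (r * suc n)
    edge e with Fin.remQuot {r} n e
    ... | (i , t) = combine i zero , combine i (suc t)

-- A leaf lies on a single edge, so its weight is that edge's label, and the leaves of
-- r K_{1,n} realise every label 1, …, rn. The centre on the edge labelled rn has weight at
-- least rn + 1 (every star has another edge), so any labelling has at least rn + 1 weights.
-- For n = 2k, give the first k edges of star i their own index and the other k edges the
-- reversed index (rn − 1 − index) of their partner: the labels of each star then form k pairs
-- summing to rn + 1, every centre weighs k (rn + 1) > rn, and exactly rn + 1 weights occur.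

module Submission where

open import Defs
open import Data.Nat using (ℕ; suc; _*_; _+_; _≤_)
open import Data.Nat.Divisibility using (_∣_; divides)

open import Data.Bool using (true; false; _∨_; if_then_else_)
open import Data.Empty using (⊥-elim)
open import Data.Fin as Fin
  using (Fin; zero; suc; toℕ; fromℕ; combine; opposite; punchIn; _↑ˡ_; _↑ʳ_)
open import Data.Fin.Properties
  using ( toℕ-injective; toℕ-combine; toℕ-↑ˡ; toℕ-↑ʳ; toℕ<n; toℕ-fromℕ
        ; opposite-prop; opposite-involutive; punchInᵢ≢i; injective⇒≤
        ; combine-injective; combine-surjective; remQuot-combine
        ; +↔⊎; *↔×)
open import Data.List using (List; _∷_; map; allFin; tabulate; length; lookup; deduplicate)
open import Data.List.Properties using (map-tabulate)
open import Data.List.Membership.Propositional using (_∈_)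
open import Data.List.Membership.Propositional.Properties
  using (∈-deduplicate⁺; ∈-deduplicate⁻; ∈-lookup; ∈-map⁺; ∈-map⁻; ∈-allFin)
open import Data.List.Relation.Unary.All as All using ()
open import Data.List.Relation.Unary.AllPairs using (_∷_)
open import Data.List.Relation.Unary.Any using (index)
open import Data.List.Relation.Unary.Any.Properties using (lookup-index)
open import Data.List.Relation.Unary.Unique.Propositional using (Unique)
open import Data.List.Relation.Unary.Unique.DecPropositional.Properties using (deduplicate-!)
open import Data.Nat using (zero; _∸_; _<_; _≟_; s≤s; z≤n)
open import Data.Nat.Properties
  using ( +-0-commutativeMonoid; +-identityʳ; +-assoc; +-comm; *-comm; *-suc
        ; m<m+n; m≤m+n; ≤-trans; ≤-reflexive; <⇒≱; m+[n∸m]≡n; m∸n+n≡m; m+n∸m≡n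
        ; +-∸-assoc; *-monoˡ-≤; suc-injective; ≤-antisym; +-mono-≤; *-identityˡ)
import Data.Nat.ListAction as List
open import Data.Nat.Tactic.RingSolver using (solve-∀)
open import Data.Product using (∃; ∃₂; _×_; _,_; proj₁; proj₂)
open import Data.Product.Function.NonDependent.Propositional using (_×-↔_)
open import Data.Sum using (_⊎_; inj₁; inj₂)
open import Function.Bundles using (Bijection; Inverse; _↔_; mk↔ₛ′)
open import Function.Construct.Composition using (_↔-∘_)
open import Function.Construct.Identity using (↔-id)
open import Function.Construct.Symmetry using (↔-sym)
open import Function.Base using (_∘_)
open import Function.Definitions using (Injective)
open import Function.Properties.Inverse using (↔⇒⤖)
open import Relation.Binary.PropositionalEquality
open import Relation.Nullary using (Dec; ¬_)
open import Relation.Nullary.Decidable using (⌊_⌋; isYes≗does; dec-true; dec-false)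

open import Algebra.Properties.CommutativeMonoid.Sum +-0-commutativeMonoid
  using (sum; sum-syntax; sum-cong-≗; sum-remove; sum-replicate-zero; ∑-distrib-+)
open ≡-Reasoning

sum-tabulate : ∀ {m} (h : Fin m → ℕ) → List.sum (tabulate h) ≡ sum h
sum-tabulate {zero}  h = refl
sum-tabulate {suc m} h = cong (h zero +_) (sum-tabulate (λ x → h (suc x)))

sum-map-allFin : ∀ {m} (h : Fin m → ℕ) → List.sum (map h (allFin m)) ≡ sum h
sum-map-allFin h = trans (cong List.sum (map-tabulate (λ x → x) h)) (sum-tabulate h)

∑-const : ∀ m c → ∑[ _ < m ] c ≡ m * c
∑-const zero    c = refl
∑-const (suc m) c = cong (c +_) (∑-const m c)

∑-zero : ∀ {m} (h : Fin m → ℕ) → (∀ x → h x ≡ 0) → sum h ≡ 0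
∑-zero {m} h zeros = trans (sum-cong-≗ zeros) (sum-replicate-zero m)

∑-single : ∀ {m} (h : Fin m → ℕ) (a : Fin m) → (∀ x → x ≢ a → h x ≡ 0) → sum h ≡ h a
∑-single {suc m} h a others = begin
  sum h                              ≡⟨ sum-remove {i = a} h ⟩
  h a + ∑[ j < m ] h (punchIn a j)   ≡⟨ cong (h a +_) (∑-zero _ (λ j → others _ (punchInᵢ≢i a j))) ⟩
  h a + 0                            ≡⟨ +-identityʳ (h a) ⟩
  h a                                ∎

<-∑ : ∀ {m} (h : Fin (suc (suc m)) → ℕ) → (∀ x → 0 < h x) → ∀ a → h a < sum h
<-∑ h positive a =
  subst (h a <_) (sym (sum-remove {i = a} h)) (m<m+n (h a) (≤-trans (positive _) (m≤m+n _ _)))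

∑-splitAt : ∀ a {b} (h : Fin (a + b) → ℕ) →
  ∑[ x < a + b ] h x ≡ ∑[ i < a ] h (i ↑ˡ b) + ∑[ j < b ] h (a ↑ʳ j)
∑-splitAt zero    h = refl
∑-splitAt (suc a) h = trans (cong (h zero +_) (∑-splitAt a (λ x → h (suc x)))) (sym (+-assoc (h zero) _ _))

∑-combine : ∀ m {n} (h : Fin (m * n) → ℕ) →
  ∑[ x < m * n ] h x ≡ ∑[ i < m ] ∑[ j < n ] h (combine i j)
∑-combine zero        h = refl
∑-combine (suc m) {n} h = trans (∑-splitAt n h)
  (cong (∑[ j < n ] h (combine {suc m} zero j) +_) (∑-combine m (λ y → h (_↑ʳ_ {m = m * n} n y))))

lookup-injective : ∀ {A : Set} {xs : List A} → Unique xs → Injective _≡_ _≡_ (lookup xs)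
lookup-injective (_  ∷ _) {zero}  {zero}  _  = refl
lookup-injective (x∉ ∷ _) {zero}  {suc j} eq = ⊥-elim (All.lookup x∉ (∈-lookup j) eq)
lookup-injective (x∉ ∷ _) {suc i} {zero}  eq = ⊥-elim (All.lookup x∉ (∈-lookup i) (sym eq))
lookup-injective (_  ∷ u) {suc i} {suc j} eq = cong suc (lookup-injective u eq)

≤-length-deduplicate : ∀ {m} {xs : List ℕ} (g : Fin m → ℕ) → Injective _≡_ _≡_ g →
  (∀ a → g a ∈ xs) → m ≤ length (deduplicate _≟_ xs)
≤-length-deduplicate {xs = xs} g g-injective g∈xs = injective⇒≤ position-injective
  where
  ys : List ℕ
  ys = deduplicate _≟_ xs
  position : ∀ a → g a ∈ ys
  position a = ∈-deduplicate⁺ _≟_ (g∈xs a)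
  position-injective : Injective _≡_ _≡_ (λ a → index (position a))
  position-injective {a} {b} eq = g-injective (begin
    g a                             ≡⟨ lookup-index (position a) ⟩
    lookup ys (index (position a))  ≡⟨ cong (lookup ys) eq ⟩
    lookup ys (index (position b))  ≡⟨ lookup-index (position b) ⟨
    g b                             ∎)

length-deduplicate-≤ : ∀ {m} {xs : List ℕ} (g : Fin m → ℕ) →
  (∀ {x} → x ∈ xs → ∃ λ a → g a ≡ x) → length (deduplicate _≟_ xs) ≤ m
length-deduplicate-≤ {xs = xs} g xs⊆image = injective⇒≤ preimage-injective
  where
  ys : List ℕ
  ys = deduplicate _≟_ xs
  preimage : ∀ j → ∃ λ a → g a ≡ lookup ys j
  preimage j = xs⊆image (∈-deduplicate⁻ _≟_ xs (∈-lookup j))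
  preimage-injective : Injective _≡_ _≡_ (λ j → proj₁ (preimage j))
  preimage-injective {i} {j} eq = lookup-injective (deduplicate-! _≟_ xs)
    (trans (sym (proj₂ (preimage i))) (trans (cong g eq) (proj₂ (preimage j))))

labelsAnd : ℕ → (M : ℕ) → Fin (suc M) → ℕ
labelsAnd W M zero    = W
labelsAnd W M (suc j) = suc (toℕ j)

labelsAnd-injective : ∀ {W M} → M < W → Injective _≡_ _≡_ (labelsAnd W M)
labelsAnd-injective M<W {zero}  {zero}  _  = refl
labelsAnd-injective M<W {zero}  {suc j} eq = ⊥-elim (<⇒≱ M<W (≤-trans (≤-reflexive eq) (toℕ<n j)))
labelsAnd-injective M<W {suc i} {zero}  eq = ⊥-elim (<⇒≱ M<W (≤-trans (≤-reflexive (sym eq)) (toℕ<n i)))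
labelsAnd-injective M<W {suc i} {suc j} eq = cong suc (toℕ-injective (suc-injective eq))

m+n≡o⇒o∸m≡n : ∀ {m n o} → m + n ≡ o → o ∸ m ≡ n
m+n≡o⇒o∸m≡n {m} {n} refl = m+n∸m≡n m n

opposite-combine : ∀ {m n} (i : Fin m) (j : Fin n) →
  opposite (combine i j) ≡ combine (opposite i) (opposite j)
opposite-combine {m} {n} i j = toℕ-injective (begin
  toℕ (opposite (combine i j))             ≡⟨ opposite-prop (combine i j) ⟩
  m * n ∸ suc (toℕ (combine i j))          ≡⟨ cong (λ x → m * n ∸ suc x) (toℕ-combine i j) ⟩
  m * n ∸ suc (n * toℕ i + toℕ j)          ≡⟨ m+n≡o⇒o∸m≡n complement ⟩
  n * p + q                                ≡⟨ cong₂ (λ x y → n * x + y) (opposite-prop i) (opposite-prop j) ⟨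
  n * toℕ (opposite i) + toℕ (opposite j)  ≡⟨ toℕ-combine (opposite i) (opposite j) ⟨
  toℕ (combine (opposite i) (opposite j))  ∎)
  where
  p q : ℕ
  p = m ∸ suc (toℕ i)
  q = n ∸ suc (toℕ j)
  regroup : ∀ n i j p q → suc (n * i + j) + (n * p + q) ≡ (suc j + q) + n * (i + p)
  regroup = solve-∀
  complement : suc (n * toℕ i + toℕ j) + (n * p + q) ≡ m * n
  complement = begin
    suc (n * toℕ i + toℕ j) + (n * p + q) ≡⟨ regroup n (toℕ i) (toℕ j) p q ⟩
    (suc (toℕ j) + q) + n * (toℕ i + p)   ≡⟨ cong (_+ n * (toℕ i + p)) (m+[n∸m]≡n (toℕ<n j)) ⟩
    n + n * (toℕ i + p)                   ≡⟨ *-suc n (toℕ i + p) ⟨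
    n * suc (toℕ i + p)                   ≡⟨ cong (n *_) (m+[n∸m]≡n (toℕ<n i)) ⟩
    n * m                                 ≡⟨ *-comm n m ⟩
    m * n                                 ∎

opposite-↑ˡ : ∀ {m} (b : Fin m) → opposite (b ↑ˡ m) ≡ m ↑ʳ opposite b
opposite-↑ˡ {m} b = toℕ-injective (begin
  toℕ (opposite (b ↑ˡ m))     ≡⟨ opposite-prop (b ↑ˡ m) ⟩
  m + m ∸ suc (toℕ (b ↑ˡ m))  ≡⟨ cong (λ x → m + m ∸ suc x) (toℕ-↑ˡ b m) ⟩
  m + m ∸ suc (toℕ b)         ≡⟨ +-∸-assoc m (toℕ<n b) ⟩
  m + (m ∸ suc (toℕ b))       ≡⟨ cong (m +_) (opposite-prop b) ⟨
  m + toℕ (opposite b)        ≡⟨ toℕ-↑ʳ m (opposite b) ⟨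
  toℕ (m ↑ʳ opposite b)       ∎)

suc-toℕ+suc-toℕ-opposite : ∀ {N} (x : Fin N) → suc (toℕ x) + suc (toℕ (opposite x)) ≡ N + 1
suc-toℕ+suc-toℕ-opposite {N} x = begin
  suc (toℕ x) + suc (toℕ (opposite x))  ≡⟨ cong (λ y → suc (toℕ x) + suc y) (opposite-prop x) ⟩
  suc (toℕ x) + suc (N ∸ suc (toℕ x))   ≡⟨ +-comm (suc (toℕ x)) _ ⟩
  suc (N ∸ suc (toℕ x) + suc (toℕ x))   ≡⟨ cong suc (m∸n+n≡m (toℕ<n x)) ⟩
  suc N                                 ≡⟨ +-comm 1 N ⟩
  N + 1                                 ∎

⌊⌋-true : ∀ {A : Set} (a? : Dec A) → A → ⌊ a? ⌋ ≡ true
⌊⌋-true a? a = trans (isYes≗does a?) (dec-true a? a)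

⌊⌋-false : ∀ {A : Set} (a? : Dec A) → ¬ A → ⌊ a? ⌋ ≡ false
⌊⌋-false a? ¬a = trans (isYes≗does a?) (dec-false a? ¬a)

contribution : (G : Graph) → Labeling G → Fin (v G) → Fin (m G) → ℕ
contribution G f u e = if incident G e u then label G f e else 0

weight≡∑contribution : ∀ G f u → weight G f u ≡ sum (contribution G f u)
weight≡∑contribution G f u = sum-map-allFin (contribution G f u)

contribution-incident : ∀ G f {u e} → incident G e u ≡ true → contribution G f u e ≡ label G f e
contribution-incident G f {e = e} e∋u = cong (λ b → if b then label G f e else 0) e∋u

contribution-not-incident : ∀ G f {u e} → incident G e u ≡ false → contribution G f u e ≡ 0
contribution-not-incident G f {e = e} e∌u = cong (λ b → if b then label G f e else 0) e∌u

weight-pendant : ∀ G f {u} (a : Fin (m G)) →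
  incident G a u ≡ true → (∀ e → e ≢ a → incident G e u ≡ false) →
  weight G f u ≡ label G f a
weight-pendant G f {u} a a∋u others = begin
  weight G f u              ≡⟨ weight≡∑contribution G f u ⟩
  sum (contribution G f u)  ≡⟨ ∑-single _ a (λ e e≢a → contribution-not-incident G f (others e e≢a)) ⟩
  contribution G f u a      ≡⟨ contribution-incident G f a∋u ⟩
  label G f a               ∎

chiLaIs-intro : ∀ G {k} (f : Labeling G) → IsLocalAntimagic G f → numWeights G f ≤ k →
  (∀ g → k ≤ numWeights G g) → ChiLaIs G k
chiLaIs-intro G f antimagic upper lower =
  (f , antimagic , ≤-antisym upper (lower f)) , λ g _ → lower g

-- Weights in r K_{1,n}

module _ {r n : ℕ} where

  private
    G : Graph
    G = rStar r n

  centre : Fin r → Fin (r * suc n)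
  centre i = combine i zero

  leaf : Fin r → Fin n → Fin (r * suc n)
  leaf i t = combine i (suc t)

  ends-combine : ∀ i t → ends G (combine i t) ≡ (centre i , leaf i t)
  ends-combine i t = cong (λ (j , s) → centre j , leaf j s) (remQuot-combine i t)

  incident-combine : ∀ i t u →
    incident G (combine i t) u ≡ ⌊ centre i Fin.≟ u ⌋ ∨ ⌊ leaf i t Fin.≟ u ⌋
  incident-combine i t u = cong (λ (c , l) → ⌊ c Fin.≟ u ⌋ ∨ ⌊ l Fin.≟ u ⌋) (ends-combine i t)

  centre≢leaf : ∀ i i' t → centre i ≢ leaf i' t
  centre≢leaf i i' t eq with () ← proj₂ (combine-injective i zero i' (suc t) eq)

  module _ (f : Labeling G) where

    weight-leaf : ∀ i t → weight G f (leaf i t) ≡ label G f (combine i t)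
    weight-leaf i t = weight-pendant G f (combine i t) own others
      where
      own : incident G (combine i t) (leaf i t) ≡ true
      own = trans (incident-combine i t (leaf i t)) (cong₂ _∨_
        (⌊⌋-false (centre i Fin.≟ leaf i t) (centre≢leaf i i t)) (⌊⌋-true (leaf i t Fin.≟ leaf i t) refl))
      others : ∀ e → e ≢ combine i t → incident G e (leaf i t) ≡ false
      others e e≢ with i' , t' , refl ← combine-surjective {r} e =
        trans (incident-combine i' t' (leaf i t))
          (cong₂ _∨_ (⌊⌋-false (centre i' Fin.≟ leaf i t) (centre≢leaf i' i t))
                     (⌊⌋-false (leaf i' t' Fin.≟ leaf i t) same-leaf))
        where
        same-leaf : leaf i' t' ≢ leaf i t
        same-leaf eq with refl , refl ← combine-injective i' (suc t') i (suc t) eq = e≢ refl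

    weight-centre : ∀ i → weight G f (centre i) ≡ ∑[ t < n ] label G f (combine i t)
    weight-centre i = begin
      weight G f (centre i)                       ≡⟨ weight≡∑contribution G f (centre i) ⟩
      sum c                                       ≡⟨ ∑-combine r c ⟩
      ∑[ i' < r ] ∑[ t < n ] c (combine i' t)     ≡⟨ ∑-single _ i other-stars ⟩
      ∑[ t < n ] c (combine i t)                  ≡⟨ sum-cong-≗ (λ t → contribution-incident G f (own-star t)) ⟩
      ∑[ t < n ] label G f (combine i t)          ∎
      where
      c : Fin (r * n) → ℕ
      c = contribution G f (centre i)
      own-star : ∀ t → incident G (combine i t) (centre i) ≡ true
      own-star t = trans (incident-combine i t (centre i))
        (cong (_∨ ⌊ leaf i t Fin.≟ centre i ⌋) (⌊⌋-true (centre i Fin.≟ centre i) refl))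
      other-star : ∀ i' t → i' ≢ i → incident G (combine i' t) (centre i) ≡ false
      other-star i' t i'≢i = trans (incident-combine i' t (centre i)) (cong₂ _∨_
        (⌊⌋-false (centre i' Fin.≟ centre i) (λ eq → i'≢i (proj₁ (combine-injective i' zero i zero eq))))
        (⌊⌋-false (leaf i' t Fin.≟ centre i) (λ eq → centre≢leaf i i' t (sym eq))))
      other-stars : ∀ i' → i' ≢ i → ∑[ t < n ] c (combine i' t) ≡ 0
      other-stars i' i'≢i = ∑-zero _ (λ t → contribution-not-incident G f (other-star i' t i'≢i))

    weights : List ℕ
    weights = map (weight G f) (allFin (r * suc n))

    numWeights-≤ : ∀ c → (∀ i → weight G f (centre i) ≡ c) → numWeights G f ≤ suc (r * n)
    numWeights-≤ c centres = length-deduplicate-≤ (labelsAnd c (r * n)) in-image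
      where
      in-image : ∀ {x} → x ∈ weights → ∃ λ a → labelsAnd c (r * n) a ≡ x
      in-image x∈ with u , _ , refl ← ∈-map⁻ (weight G f) x∈ with combine-surjective {r} u
      ... | i , zero  , refl = zero , sym (centres i)
      ... | i , suc t , refl = suc (Bijection.to f (combine i t)) , sym (weight-leaf i t)

    heavy-centres⇒antimagic : (∀ i → r * n < weight G f (centre i)) → IsLocalAntimagic G f
    heavy-centres⇒antimagic heavy e with i , t , refl ← combine-surjective {r} e =
      subst (λ (c , l) → weight G f c ≢ weight G f l) (sym (ends-combine i t)) centre≢leaf-weight
      where
      centre≢leaf-weight : weight G f (centre i) ≢ weight G f (leaf i t)
      centre≢leaf-weight eq = <⇒≱ (heavy i)
        (≤-trans (≤-reflexive (trans eq (weight-leaf i t))) (toℕ<n (Bijection.to f (combine i t))))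

≤-numWeights : ∀ {r n} → 1 ≤ r → 2 ≤ n → (f : Labeling (rStar r n)) → suc (r * n) ≤ numWeights (rStar r n) f
≤-numWeights {r} {n} (s≤s z≤n) (s≤s (s≤s z≤n)) f =
  ≤-length-deduplicate (labelsAnd W (r * n)) (labelsAnd-injective rn<W) attained
  where
  open Bijection f using (to; strictlySurjective)
  G : Graph
  G = rStar r n
  edgeLabelled : ∀ j → ∃₂ λ i t → to (combine i t) ≡ j
  edgeLabelled j with e , to-e≡j ← strictlySurjective j with i , t , refl ← combine-surjective {r} e = i , t , to-e≡j
  -- Matching on the bounds made r * n a successor, so fromℕ _ is the top index rn − 1.
  i* : Fin r
  i* = proj₁ (edgeLabelled (fromℕ _))
  t* : Fin n
  t* = proj₁ (proj₂ (edgeLabelled (fromℕ _)))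
  W : ℕ
  W = weight G f (centre i*)
  rn<W : r * n < W
  rn<W = subst₂ _<_ top-label (sym (weight-centre f i*))
    (<-∑ (λ t → label G f (combine i* t)) (λ _ → s≤s z≤n) t*)
    where
    top-label : label G f (combine i* t*) ≡ r * n
    top-label = cong suc (trans (cong toℕ (proj₂ (proj₂ (edgeLabelled (fromℕ _))))) (toℕ-fromℕ _))
  attained : ∀ a → labelsAnd W (r * n) a ∈ weights {r} {n} f
  attained zero = ∈-map⁺ (weight G f) (∈-allFin (centre i*))
  attained (suc j) with i , t , refl ← edgeLabelled j =
    subst (_∈ weights {r} {n} f) (weight-leaf f i t) (∈-map⁺ (weight G f) (∈-allFin (leaf i t)))

-- A labelling of r K_{1,2k} with all centres of equal weight

module _ (r k : ℕ) where

  edgeCode : Fin (r * (k + k)) ↔ (Fin r × (Fin k ⊎ Fin k))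
  edgeCode = (↔-id (Fin r) ×-↔ +↔⊎) ↔-∘ *↔×

  reflect : Fin r × (Fin k ⊎ Fin k) → Fin r × (Fin k ⊎ Fin k)
  reflect (i , inj₁ a) = i , inj₁ a
  reflect (i , inj₂ a) = opposite i , inj₂ (opposite a)

  reflect-involutive : ∀ x → reflect (reflect x) ≡ x
  reflect-involutive (i , inj₁ a) = refl
  reflect-involutive (i , inj₂ a) = cong₂ (λ j b → j , inj₂ b) (opposite-involutive i) (opposite-involutive a)

  pairedLabeling : Labeling (rStar r (k + k))
  pairedLabeling = ↔⇒⤖ (↔-sym edgeCode ↔-∘ (reflect↔ ↔-∘ edgeCode))
    where
    reflect↔ : (Fin r × (Fin k ⊎ Fin k)) ↔ (Fin r × (Fin k ⊎ Fin k))
    reflect↔ = mk↔ₛ′ reflect reflect reflect-involutive reflect-involutive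

  private
    σ : Fin (r * (k + k)) → Fin (r * (k + k))
    σ = Bijection.to pairedLabeling

    σ-from : ∀ x → σ (Inverse.from edgeCode x) ≡ Inverse.from edgeCode (reflect x)
    σ-from x = cong (Inverse.from edgeCode ∘ reflect) (Inverse.strictlyInverseˡ edgeCode x)

  σ-↑ʳ : ∀ i a → σ (combine i (k ↑ʳ a)) ≡ opposite (σ (combine i (a ↑ˡ k)))
  σ-↑ʳ i a = begin
    σ (combine i (k ↑ʳ a))                   ≡⟨ σ-from (i , inj₂ a) ⟩
    combine (opposite i) (k ↑ʳ opposite a)   ≡⟨ cong (combine (opposite i)) (opposite-↑ˡ a) ⟨
    combine (opposite i) (opposite (a ↑ˡ k)) ≡⟨ opposite-combine i (a ↑ˡ k) ⟨
    opposite (combine i (a ↑ˡ k))            ≡⟨ cong opposite (σ-from (i , inj₁ a)) ⟨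
    opposite (σ (combine i (a ↑ˡ k)))        ∎

  weight-centre-paired : ∀ i → weight (rStar r (k + k)) pairedLabeling (centre i) ≡ k * (r * (k + k) + 1)
  weight-centre-paired i = begin
    weight G pairedLabeling (centre i)        ≡⟨ weight-centre pairedLabeling i ⟩
    ∑[ t < k + k ] ℓ (combine i t)            ≡⟨ ∑-splitAt k (λ t → ℓ (combine i t)) ⟩
    ∑[ a < k ] ℓ₁ a + ∑[ a < k ] ℓ₂ a         ≡⟨ ∑-distrib-+ ℓ₁ ℓ₂ ⟨
    ∑[ a < k ] (ℓ₁ a + ℓ₂ a)                  ≡⟨ sum-cong-≗ pair ⟩
    ∑[ a < k ] (r * (k + k) + 1)              ≡⟨ ∑-const k (r * (k + k) + 1) ⟩
    k * (r * (k + k) + 1)                     ∎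
    where
    G : Graph
    G = rStar r (k + k)
    ℓ : Fin (r * (k + k)) → ℕ
    ℓ = label G pairedLabeling
    ℓ₁ ℓ₂ : Fin k → ℕ
    ℓ₁ a = ℓ (combine i (a ↑ˡ k))
    ℓ₂ a = ℓ (combine i (k ↑ʳ a))
    pair : ∀ a → ℓ₁ a + ℓ₂ a ≡ r * (k + k) + 1
    pair a = trans (cong (λ x → ℓ₁ a + suc (toℕ x)) (σ-↑ʳ i a))
      (suc-toℕ+suc-toℕ-opposite (σ (combine i (a ↑ˡ k))))

chiLaIs-rStar-double : ∀ {r k} → 1 ≤ r → 1 ≤ k → ChiLaIs (rStar r (k + k)) (r * (k + k) + 1)
chiLaIs-rStar-double {r} {k} 1≤r 1≤k = subst (ChiLaIs G) (+-comm 1 (r * n))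
  (chiLaIs-intro G (pairedLabeling r k)
    (heavy-centres⇒antimagic (pairedLabeling r k) (λ i → subst (r * n <_) (sym (weight-centre-paired r k i)) rn<c))
    (numWeights-≤ (pairedLabeling r k) c (weight-centre-paired r k))
    (≤-numWeights 1≤r (+-mono-≤ 1≤k 1≤k)))
  where
  n c : ℕ
  n = k + k
  c = k * (r * n + 1)
  G : Graph
  G = rStar r n
  rn<c : r * n < c
  rn<c = subst (_≤ c) (trans (*-identityˡ (r * n + 1)) (+-comm (r * n) 1)) (*-monoˡ-≤ (r * n + 1) 1≤k)

mainTheorem5 : (r n : ℕ) → 1 ≤ r → 2 ≤ n → 2 ∣ n →
    ChiLaIs (rStar r n) (r * n + 1)
mainTheorem5 r _ _   ()  (divides zero refl)
mainTheorem5 r _ 1≤r _   (divides k@(suc _) refl) =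
  subst (λ n → ChiLaIs (rStar r n) (r * n + 1)) (double k) (chiLaIs-rStar-double 1≤r (s≤s z≤n))
  where
  double : ∀ k → k + k ≡ k * 2
  double = solve-∀
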